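{- Let $P_n$ be the path on $n$ vertices and let $x,y\ge 1$ be integers with $x+y\le n$. In the game on $P_n$ starting with $x$ ignorant agents and $y$ knowledgeable agents, Adversary can force a time of $(n-x-y)/2$ before an additional agent becomes knowledgeable, but no longer.
   Context: For a finite connected graph $G$, the game with $x$ ignorant and $y$ knowledgeable agents is played as follows. Setup: Adversary places $y$ knowledgeable and $x$ ignorant agents on $x+y$ distinct vertices of $G$. At each time $t=1,2,\ldots$: first Adversary selects an arbitrary connected spanning subgraph $G_t$ of $G$; then each agent either stays at its vertex or moves to a vertex adjacent to it in $G_t$. If after this move several agents are at the same vertex and at least one of them was knowledgeable at time $t-1$, all of them become knowledgeable at time $t$. Time is measured in rounds. -}

module Defs where

open import Data.Nat using (ℕ; zero; suc)
open import Data.Fin using (Fin; toℕ)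
open import Data.Sum using (_⊎_; inj₁; inj₂)
open import Data.Product using (Σ; _×_)
open import Data.Unit using (⊤)
open import Data.Empty using (⊥)
open import Relation.Nullary using (¬_)
open import Relation.Binary.PropositionalEquality using (_≡_)
open import Relation.Binary.Construct.Closure.ReflexiveTransitive using (Star)
open import Function.Definitions using (Injective)

Graph : ℕ → Set₁
Graph n = Fin n → Fin n → Set

PathGraph : (n : ℕ) → Graph n
PathGraph n u v = (toℕ v ≡ suc (toℕ u)) ⊎ (toℕ u ≡ suc (toℕ v))

record ConnectedSpanningSubgraph {n : ℕ} (G : Graph n) : Set₁ where
  field
    E         : Graph n
    sub       : ∀ {u v} → E u v → G u v
    symmetric : ∀ {u v} → E u v → E v u
    connected : ∀ u v → Star E u v
open ConnectedSpanningSubgraph public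

-- Agents: inj₁ i (i < y) are the initially knowledgeable agents,
--         inj₂ j (j < x) are the initially ignorant agents.
Agent : ℕ → ℕ → Set
Agent x y = Fin y ⊎ Fin x

record State (n x y : ℕ) : Set₁ where
  field
    pos  : Agent x y → Fin n
    know : Agent x y → Set
open State public

Placement : ℕ → ℕ → ℕ → Set
Placement n x y = Σ (Agent x y → Fin n) (λ p → Injective _≡_ _≡_ p)

isKnowledgeable₀ : {x y : ℕ} → Agent x y → Set
isKnowledgeable₀ (inj₁ _) = ⊤
isKnowledgeable₀ (inj₂ _) = ⊥

initial : {n x y : ℕ} → (Agent x y → Fin n) → State n x y
initial p = record { pos = p ; know = isKnowledgeable₀ }

LegalMove : {n x y : ℕ} {G : Graph n} → ConnectedSpanningSubgraph G →
            State n x y → (Agent x y → Fin n) → Set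
LegalMove H s p' = ∀ a → (p' a ≡ pos s a) ⊎ E H (pos s a) (p' a)

step : {n x y : ℕ} → State n x y → (Agent x y → Fin n) → State n x y
step s p' = record
  { pos  = p'
  ; know = λ a → know s a ⊎ Σ _ (λ b → (p' b ≡ p' a) × know s b) }

NewKnowledge : {n x y : ℕ} → State n x y → Set
NewKnowledge {x = x} s = Σ (Fin x) (λ j → know s (inj₂ j))

-- The agents can guarantee that an additional agent is knowledgeable
-- by time k (at most k further rounds), whatever the Adversary does.
data AgentsWin {n x y : ℕ} (G : Graph n) : ℕ → State n x y → Set₁ where
  done : ∀ {k s} → NewKnowledge s → AgentsWin G k s
  play : ∀ {k s} →
         ((H : ConnectedSpanningSubgraph G) →
            Σ (Agent x y → Fin n) (λ p' → LegalMove H s p' × AgentsWin G k (step s p'))) →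
         AgentsWin G (suc k) s

-- The Adversary can guarantee that no additional agent is knowledgeable
-- at any of the times 0,1,...,k (counted from the current state).
data AdvSurvives {n x y : ℕ} (G : Graph n) : ℕ → State n x y → Set₁ where
  end   : ∀ {s} → ¬ NewKnowledge s → AdvSurvives G zero s
  stall : ∀ {k s} → ¬ NewKnowledge s →
          Σ (ConnectedSpanningSubgraph G)
            (λ H → (p' : Agent x y → Fin n) → LegalMove H s p' → AdvSurvives G k (step s p')) →
          AdvSurvives G (suc k) s

{-# OPTIONS --safe #-}
-- A connected spanning subgraph of a path contains every edge of it, so whatever the Adversary
-- does, each agent may step to either neighbour in every round, and never further.
--
-- Adversary: put the knowledgeable agents on 0, …, y-1 and the ignorant ones on n-x, …, n-1.
-- Knowledge can spread by one vertex per round and the ignorant agents can approach by one,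
-- so the n - x - y free vertices between them keep the two groups apart for (n - x - y)/2 rounds.
--
-- Agents: in any placement some knowledgeable and some ignorant agent are consecutive along
-- the path. Only free vertices lie between them, at most n - x - y of them, and walking
-- towards each other the two agents close the distance by two per round.
module Submission where

open import Defs
open import Data.Nat using (ℕ; zero; suc; pred; _+_; _*_; _∸_; _≤_; _<_; _<?_; s≤s; s≤s⁻¹)
open import Data.Nat.Properties
open import Data.Fin using (Fin; toℕ; fromℕ<; inject₁; splitAt; join)
open import Data.Fin.Properties using (toℕ-injective; toℕ<n; toℕ-fromℕ<; toℕ-inject₁; join-splitAt; injective⇒≤; any?)
open import Data.Sum using (_⊎_; inj₁; inj₂; [_,_]; swap; map₂)
import Data.Sum as Sum
open import Data.Sum.Properties using (≡-dec)
open import Data.Product using (Σ; ∃₂; _×_; _,_; proj₁)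
open import Data.Unit using (tt)
open import Function using (_∘_; id)
open import Relation.Binary using (Rel; DecidableEquality; tri<; tri≈; tri>)
open import Relation.Nullary using (¬_; Dec; yes; no; contradiction)
open import Relation.Nullary.Decidable using (_×-dec_; _⊎-dec_; map′)
open import Relation.Unary using (Pred; Decidable)
open import Relation.Binary.PropositionalEquality using (_≡_; _≢_; refl; sym; trans; cong; subst; subst₂; module ≡-Reasoning)
open import Relation.Binary.Construct.Closure.ReflexiveTransitive using (Star; ε; _◅_; _◅◅_; gmap; reverse)
open import Function.Definitions using (Injective)

+-2*-suc : ∀ m k → m + 2 * suc k ≡ suc (suc m + 2 * k)
+-2*-suc m k = begin
  m + 2 * suc k         ≡⟨ cong (m +_) (*-suc 2 k) ⟩
  m + suc (suc (2 * k)) ≡⟨ +-suc m (suc (2 * k)) ⟩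
  suc (m + suc (2 * k)) ≡⟨ cong suc (+-suc m (2 * k)) ⟩
  suc (suc m + 2 * k)   ∎
  where open ≡-Reasoning

m+n≤o⇒n≤o∸m : ∀ m {n o} → m + n ≤ o → n ≤ o ∸ m
m+n≤o⇒n≤o∸m m {n} {o} m+n≤o = m+n≤o⇒m≤o∸n n (subst (_≤ o) (+-comm m n) m+n≤o)

walk-exits : ∀ {a ℓ p} {I : Set a} {E : Rel I ℓ} {P : Pred I p} → Decidable P →
             ∀ {s t} → Star E s t → ¬ P s → P t → ∃₂ λ u v → ¬ P u × P v × E u v
walk-exits P? ε ¬Ps Pt = contradiction Pt ¬Ps
walk-exits P? (_◅_ {j = w} e walk) ¬Ps Pt with P? w
... | yes Pw = _ , _ , ¬Ps , Pw , e
... | no ¬Pw = walk-exits P? walk ¬Pw Pt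

splitAt-injective : ∀ m {n} → Injective _≡_ _≡_ (splitAt m {n})
splitAt-injective m {n} {i} {j} eq =
  trans (sym (join-splitAt m n i)) (trans (cong (join m n) eq) (join-splitAt m n j))

injective-avoiding-interval⇒≤ : ∀ {m n} {f : Fin m → Fin n} → Injective _≡_ _≡_ f →
  ∀ b e → b + e ≤ n → (∀ i → ¬ (b ≤ toℕ (f i) × toℕ (f i) < b + e)) → e + m ≤ n
injective-avoiding-interval⇒≤ {m} {n} {f} f-inj b e b+e≤n avoids =
  injective⇒≤ {f = g ∘ splitAt e} (splitAt-injective e ∘ g-injective)
  where
  inside : ∀ (k : Fin e) → b + toℕ k < b + e
  inside k = +-monoʳ-< b (toℕ<n k)
  gap : Fin e → Fin n
  gap k = fromℕ< (<-≤-trans (inside k) b+e≤n)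
  gap-toℕ : ∀ k → toℕ (gap k) ≡ b + toℕ k
  gap-toℕ k = toℕ-fromℕ< _
  gap-avoided : ∀ k i → gap k ≢ f i
  gap-avoided k i eq = avoids i (subst (λ v → b ≤ v × v < b + e) (trans (sym (gap-toℕ k)) (cong toℕ eq))
                                       (m≤m+n b (toℕ k) , inside k))
  g : Fin e ⊎ Fin m → Fin n
  g = [ gap , f ]
  g-injective : Injective _≡_ _≡_ g
  g-injective {inj₁ k} {inj₁ k′} eq =
    cong inj₁ (toℕ-injective (+-cancelˡ-≡ b _ _ (trans (sym (gap-toℕ k)) (trans (cong toℕ eq) (gap-toℕ k′)))))
  g-injective {inj₁ k} {inj₂ i} eq = contradiction eq (gap-avoided k i)
  g-injective {inj₂ i} {inj₁ k} eq = contradiction (sym eq) (gap-avoided k i)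
  g-injective {inj₂ i} {inj₂ i′} eq = cong inj₂ (f-inj eq)

module _ {n : ℕ} where

  stay-or-adjacent⇒≤suc : ∀ {u v : Fin n} → v ≡ u ⊎ PathGraph n u v → toℕ v ≤ suc (toℕ u)
  stay-or-adjacent⇒≤suc (inj₁ refl)         = n≤1+n _
  stay-or-adjacent⇒≤suc (inj₂ (inj₁ v≡1+u)) = ≤-reflexive v≡1+u
  stay-or-adjacent⇒≤suc (inj₂ (inj₂ u≡1+v)) = ≤-trans (n≤1+n _) (≤-trans (≤-reflexive (sym u≡1+v)) (n≤1+n _))

  edge-across : ∀ {u v : Fin n} c → PathGraph n u v → toℕ u ≤ c → c < toℕ v → toℕ u ≡ c × toℕ v ≡ suc c
  edge-across c (inj₁ v≡1+u) u≤c c<v = u≡c , trans v≡1+u (cong suc u≡c)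
    where u≡c = ≤-antisym u≤c (s≤s⁻¹ (subst (c <_) v≡1+u c<v))
  edge-across {u} {v} c (inj₂ u≡1+v) u≤c c<v =
    contradiction (≤-trans (n≤1+n (toℕ v)) (≤-trans (≤-reflexive (sym u≡1+v)) u≤c)) (<⇒≱ c<v)

  successor : ∀ {m} {v : Fin n} → m < toℕ v → Σ (Fin n) λ w → toℕ w ≡ suc m
  successor {v = v} m<v = fromℕ< (≤-<-trans m<v (toℕ<n v)) , toℕ-fromℕ< _

  predecessor : ∀ {m} {v : Fin n} → m < toℕ v → Σ (Fin n) λ w → toℕ v ≡ suc (toℕ w)
  predecessor {v = Fin.suc w} _ = inject₁ w , cong suc (sym (toℕ-inject₁ w))

walk-to-zero : ∀ {n} (u : Fin (suc n)) → Star (PathGraph (suc n)) u Fin.zero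
walk-to-zero Fin.zero = ε
walk-to-zero {suc n} (Fin.suc u) = gmap Fin.suc (Sum.map (cong suc) (cong suc)) (walk-to-zero u) ◅◅ inj₂ refl ◅ ε

path-connected : ∀ {n} (u v : Fin n) → Star (PathGraph n) u v
path-connected {suc n} u v = walk-to-zero u ◅◅ reverse swap (walk-to-zero v)

pathSubgraph : ∀ n → ConnectedSpanningSubgraph (PathGraph n)
pathSubgraph n = record { E = PathGraph n ; sub = id ; symmetric = swap ; connected = path-connected }

-- A walk in H from u to v must step from {≤ u} to {> u}, and the only path edge doing so is u v.
spanning-contains-edge : ∀ {n} (H : ConnectedSpanningSubgraph (PathGraph n)) {u v : Fin n} →
                         toℕ v ≡ suc (toℕ u) → E H u v
spanning-contains-edge H {u} {v} v≡1+u
  with walk-exits (λ w → toℕ u <? toℕ w) (connected H u v) (n≮n (toℕ u)) (≤-reflexive (sym v≡1+u))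
... | a , b , u≮a , u<b , e with edge-across (toℕ u) (sub H e) (≮⇒≥ u≮a) u<b
... | a≡u , b≡1+u with toℕ-injective a≡u | toℕ-injective (trans b≡1+u (sym v≡1+u))
... | refl | refl = e

module _ {n : ℕ} (H : ConnectedSpanningSubgraph (PathGraph n)) {u v : Fin n} where

  move-≤suc : v ≡ u ⊎ E H u v → toℕ v ≤ suc (toℕ u)
  move-≤suc = stay-or-adjacent⇒≤suc ∘ map₂ (sub H)

  move-≥pred : v ≡ u ⊎ E H u v → toℕ u ≤ suc (toℕ v)
  move-≥pred = stay-or-adjacent⇒≤suc ∘ Sum.map sym (sub H ∘ symmetric H)

module _ {n x y : ℕ} where

  record Separated (s : State n x y) (L R : ℕ) : Set where
    field
      knowers-left    : ∀ a → know s a → toℕ (pos s a) < L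
      ignorants-right : ∀ j → R ≤ toℕ (pos s (inj₂ j))
  open Separated

  separated⇒¬new : ∀ {s L R} → Separated s L R → L ≤ R → ¬ NewKnowledge s
  separated⇒¬new sep L≤R (j , knows) =
    <⇒≱ (knowers-left sep (inj₂ j) knows) (≤-trans L≤R (ignorants-right sep j))

  separated-step : ∀ H {s p′ L R} → LegalMove H s p′ →
                   Separated s L R → Separated (step s p′) (suc L) (pred R)
  knowers-left (separated-step H legal sep) a (inj₁ knows) =
    s≤s (≤-trans (move-≤suc H (legal a)) (knowers-left sep a knows))
  knowers-left (separated-step H legal sep) a (inj₂ (b , same , knows)) =
    subst (λ v → toℕ v < suc _) same (s≤s (≤-trans (move-≤suc H (legal b)) (knowers-left sep b knows)))
  ignorants-right (separated-step H legal sep) j =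
    pred-mono-≤ (≤-trans (ignorants-right sep j) (move-≥pred H (legal (inj₂ j))))

  separated⇒survives : ∀ k {s L R} → Separated s L R → L + 2 * k ≤ R → AdvSurvives (PathGraph n) k s
  separated⇒survives zero    sep bound = end (separated⇒¬new sep (≤-trans (m≤m+n _ 0) bound))
  separated⇒survives (suc k) {L = L} {R} sep bound =
    stall (separated⇒¬new sep (≤-trans (m≤m+n L _) bound))
          (pathSubgraph n , λ p′ legal → separated⇒survives k (separated-step (pathSubgraph n) legal sep) bound′)
    where
    bound′ : suc L + 2 * k ≤ pred R
    bound′ = <⇒≤pred (subst (_≤ R) (+-2*-suc L k) bound)

  separatedPlacement : x + y ≤ n → Σ (Placement n x y) λ p → Separated (initial (proj₁ p)) y (n ∸ x)
  separatedPlacement x+y≤n = (place , place-injective) , record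
    { knowers-left = λ { (inj₁ i) _ → subst (_< y) (sym (toℕ-fromℕ< _)) (toℕ<n i) }
    ; ignorants-right = λ j → subst (n ∸ x ≤_) (sym (toℕ-fromℕ< _)) (m≤m+n (n ∸ x) (toℕ j)) }
    where
    y≤n∸x : y ≤ n ∸ x
    y≤n∸x = m+n≤o⇒n≤o∸m x x+y≤n
    spot : Agent x y → ℕ
    spot (inj₁ i) = toℕ i
    spot (inj₂ j) = n ∸ x + toℕ j
    spot<n : ∀ a → spot a < n
    spot<n (inj₁ i) = <-≤-trans (toℕ<n i) (≤-trans y≤n∸x (m∸n≤m n x))
    spot<n (inj₂ j) = <-≤-trans (+-monoʳ-< (n ∸ x) (toℕ<n j))
                                (≤-reflexive (m∸n+n≡m (≤-trans (m≤m+n x y) x+y≤n)))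
    knower<ignorant : ∀ i j → spot (inj₁ i) < spot (inj₂ j)
    knower<ignorant i j = <-≤-trans (toℕ<n i) (≤-trans y≤n∸x (m≤m+n (n ∸ x) (toℕ j)))
    spot-injective : Injective _≡_ _≡_ spot
    spot-injective {inj₁ i} {inj₁ i′} eq = cong inj₁ (toℕ-injective eq)
    spot-injective {inj₁ i} {inj₂ j}  eq = contradiction eq (<⇒≢ (knower<ignorant i j))
    spot-injective {inj₂ j} {inj₁ i}  eq = contradiction (sym eq) (<⇒≢ (knower<ignorant i j))
    spot-injective {inj₂ j} {inj₂ j′} eq = cong inj₂ (toℕ-injective (+-cancelˡ-≡ (n ∸ x) _ _ eq))
    place : Agent x y → Fin n
    place a = fromℕ< (spot<n a)
    place-injective : Injective _≡_ _≡_ place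
    place-injective eq = spot-injective (trans (sym (toℕ-fromℕ< _)) (trans (cong toℕ eq) (toℕ-fromℕ< _)))

  adversary-survives : x + y ≤ n → ∀ T → 2 * T ≤ n ∸ (x + y) →
                       Σ (Placement n x y) λ p → AdvSurvives (PathGraph n) T (initial (proj₁ p))
  adversary-survives x+y≤n T 2T≤gap with separatedPlacement x+y≤n
  ... | p , sep = p , separated⇒survives T sep (begin
    y + 2 * T             ≤⟨ +-monoʳ-≤ y (subst (2 * T ≤_) (sym (∸-+-assoc n x y)) 2T≤gap) ⟩
    y + (n ∸ x ∸ y)       ≡⟨ m+[n∸m]≡n (m+n≤o⇒n≤o∸m x x+y≤n) ⟩
    n ∸ x                 ∎)
    where open ≤-Reasoning

module _ {x y : ℕ} where

  data Opposite : Agent x y → Agent x y → Set where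
    knower-left  : ∀ {i j} → Opposite (inj₁ i) (inj₂ j)
    knower-right : ∀ {i j} → Opposite (inj₂ j) (inj₁ i)

  opposite-split : ∀ {l r} c → Opposite l r → Opposite l c ⊎ Opposite c r
  opposite-split (inj₁ _) knower-left  = inj₂ knower-left
  opposite-split (inj₂ _) knower-left  = inj₁ knower-left
  opposite-split (inj₁ _) knower-right = inj₁ knower-right
  opposite-split (inj₂ _) knower-right = inj₂ knower-right

module _ {n x y : ℕ} where

  _≟ᴬ_ : DecidableEquality (Agent x y)
  _≟ᴬ_ = ≡-dec Data.Fin._≟_ Data.Fin._≟_

  relocate : (Agent x y → Fin n) → Agent x y → Fin n → Agent x y → Fin n → Agent x y → Fin n
  relocate p l u r v c with c ≟ᴬ l
  ... | yes _ = u
  ... | no _ with c ≟ᴬ r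
  ...   | yes _ = v
  ...   | no _ = p c

  relocate-left : ∀ p l u r v → relocate p l u r v l ≡ u
  relocate-left p l u r v with l ≟ᴬ l
  ... | yes _ = refl
  ... | no l≢l = contradiction refl l≢l

  relocate-right : ∀ p {l} u r v → l ≢ r → relocate p l u r v r ≡ v
  relocate-right p {l} u r v l≢r with r ≟ᴬ l
  ... | yes r≡l = contradiction (sym r≡l) l≢r
  ... | no _ with r ≟ᴬ r
  ...   | yes _ = refl
  ...   | no r≢r = contradiction refl r≢r

  relocate-legal : ∀ (H : ConnectedSpanningSubgraph (PathGraph n)) s {l u r v} →
                   u ≡ pos s l ⊎ E H (pos s l) u → v ≡ pos s r ⊎ E H (pos s r) v →
                   LegalMove H s (relocate (pos s) l u r v)
  relocate-legal H s {l} {r = r} move-l move-r c with c ≟ᴬ l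
  ... | yes refl = move-l
  ... | no _ with c ≟ᴬ r
  ...   | yes refl = move-r
  ...   | no _ = inj₁ refl

  data Informs (s : State n x y) : Agent x y → Agent x y → Set where
    left-knows  : ∀ {l} j → know s l → Informs s l (inj₂ j)
    right-knows : ∀ {r} j → know s r → Informs s (inj₂ j) r

  informs-step : ∀ {s l r} p′ → Informs s l r → Informs (step s p′) l r
  informs-step p′ (left-knows j knows)  = left-knows j (inj₁ knows)
  informs-step p′ (right-knows j knows) = right-knows j (inj₁ knows)

  informs-meet : ∀ {s l r} p′ → Informs s l r → p′ l ≡ p′ r → NewKnowledge (step s p′)
  informs-meet {l = l} p′ (left-knows j knows)  same = j , inj₂ (l , same , knows)
  informs-meet {r = r} p′ (right-knows j knows) same = j , inj₂ (r , sym same , knows)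

  ordered⇒≢ : ∀ {p : Agent x y → Fin n} {l r} → toℕ (p l) < toℕ (p r) → l ≢ r
  ordered⇒≢ l<r refl = <⇒≢ l<r refl

  approach : ∀ k (H : ConnectedSpanningSubgraph (PathGraph n)) s {l r} →
             toℕ (pos s l) < toℕ (pos s r) → toℕ (pos s r) ≤ toℕ (pos s l) + 2 * suc k →
             Σ (Agent x y → Fin n) λ p′ → LegalMove H s p′ ×
               toℕ (p′ l) ≤ toℕ (p′ r) × toℕ (p′ r) ≤ toℕ (p′ l) + 2 * k
  approach k H s {l} {r} l<r bound with m≤n⇒m<n∨m≡n l<r
  ... | inj₂ r≡1+l = p′ , relocate-legal H s (inj₂ (spanning-contains-edge H (sym r≡1+l))) (inj₁ refl) ,
                     ≤-reflexive (cong toℕ same) , ≤-trans (≤-reflexive (cong toℕ (sym same))) (m≤m+n _ _)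
    where
    p′ = relocate (pos s) l (pos s r) r (pos s r)
    same : p′ l ≡ p′ r
    same = trans (relocate-left (pos s) l _ r _) (sym (relocate-right (pos s) _ r _ (ordered⇒≢ l<r)))
  ... | inj₁ 1+l<r with successor l<r | predecessor 1+l<r
  ... | u , u≡1+l | v , r≡1+v =
    p′ , relocate-legal H s (inj₂ (spanning-contains-edge H u≡1+l)) (inj₂ (symmetric H (spanning-contains-edge H r≡1+v))) ,
    ordered , close
    where
    p′ = relocate (pos s) l u r v
    at-l : toℕ (p′ l) ≡ suc (toℕ (pos s l))
    at-l = trans (cong toℕ (relocate-left (pos s) l u r v)) u≡1+l
    at-r : toℕ (pos s r) ≡ suc (toℕ (p′ r))
    at-r = trans r≡1+v (cong (suc ∘ toℕ) (sym (relocate-right (pos s) u r v (ordered⇒≢ l<r))))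
    ordered : toℕ (p′ l) ≤ toℕ (p′ r)
    ordered = s≤s⁻¹ (subst₂ (λ a b → suc a ≤ b) (sym at-l) at-r 1+l<r)
    close : toℕ (p′ r) ≤ toℕ (p′ l) + 2 * k
    close = s≤s⁻¹ (begin
      suc (toℕ (p′ r))                  ≡⟨ sym at-r ⟩
      toℕ (pos s r)                     ≤⟨ bound ⟩
      toℕ (pos s l) + 2 * suc k         ≡⟨ +-2*-suc _ k ⟩
      suc (suc (toℕ (pos s l)) + 2 * k) ≡⟨ cong (λ a → suc (a + 2 * k)) (sym at-l) ⟩
      suc (toℕ (p′ l) + 2 * k)          ∎)
      where open ≤-Reasoning

  chase : ∀ k (s : State n x y) {l r} → Informs s l r → toℕ (pos s l) < toℕ (pos s r) →
          toℕ (pos s r) ≤ toℕ (pos s l) + 2 * k → AgentsWin (PathGraph n) k s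
  chase zero s _ l<r bound = contradiction (≤-trans bound (≤-reflexive (+-identityʳ _))) (<⇒≱ l<r)
  chase (suc k) s {l} {r} informs l<r bound = play respond
    where
    respond : (H : ConnectedSpanningSubgraph (PathGraph n)) →
              Σ (Agent x y → Fin n) λ p′ → LegalMove H s p′ × AgentsWin (PathGraph n) k (step s p′)
    respond H with approach k H s l<r bound
    ... | p′ , legal , l′≤r′ , bound′ with m≤n⇒m<n∨m≡n l′≤r′
    ...   | inj₁ l′<r′ = p′ , legal , chase k (step s p′) (informs-step p′ informs) l′<r′ bound′
    ...   | inj₂ l′≡r′ = p′ , legal , done (informs-meet p′ informs (toℕ-injective l′≡r′))

  opposite⇒informs : ∀ {q : Agent x y → Fin n} {l r} → Opposite l r → Informs (initial q) l r
  opposite⇒informs (knower-left {j = j})  = left-knows j tt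
  opposite⇒informs (knower-right {j = j}) = right-knows j tt

module _ {n x y : ℕ} (q : Agent x y → Fin n) where

  Between : Agent x y → Agent x y → Agent x y → Set
  Between l r c = toℕ (q l) < toℕ (q c) × toℕ (q c) < toℕ (q r)

  between? : ∀ l r → Dec (Σ (Agent x y) (Between l r))
  between? l r = map′ [ (λ (i , b) → inj₁ i , b) , (λ (j , b) → inj₂ j , b) ]
                      (λ { (inj₁ i , b) → inj₁ (i , b) ; (inj₂ j , b) → inj₂ (j , b) })
                      (any? (between?′ ∘ inj₁) ⊎-dec any? (between?′ ∘ inj₂))
    where
    between?′ : ∀ c → Dec (Between l r c)
    between?′ c = (toℕ (q l) <? toℕ (q c)) ×-dec (toℕ (q c) <? toℕ (q r))

  record OppositeNeighbours : Set where
    field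
      left right      : Agent x y
      opposite        : Opposite left right
      ordered         : toℕ (q left) < toℕ (q right)
      nothing-between : ∀ c → ¬ Between left right c

  narrowToNeighbours : ∀ d {l r} → Opposite l r → toℕ (q l) < toℕ (q r) → toℕ (q r) ≤ toℕ (q l) + d → OppositeNeighbours
  narrowToNeighbours zero _ l<r bound = contradiction (≤-trans bound (≤-reflexive (+-identityʳ _))) (<⇒≱ l<r)
  narrowToNeighbours (suc d) {l} {r} opp l<r bound with between? l r
  ... | no none = record { left = l ; right = r ; opposite = opp ; ordered = l<r ; nothing-between = λ c b → none (c , b) }
  ... | yes (c , l<c , c<r) with opposite-split c opp
  ...   | inj₁ opp-lc = narrowToNeighbours d opp-lc l<c (s≤s⁻¹ (≤-trans c<r (≤-trans bound (≤-reflexive (+-suc _ d)))))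
  ...   | inj₂ opp-cr = narrowToNeighbours d opp-cr c<r (≤-trans bound (≤-trans (≤-reflexive (+-suc _ d)) (+-monoˡ-≤ d l<c)))

  oppositeNeighbours : Fin y → Fin x → Injective _≡_ _≡_ q → OppositeNeighbours
  oppositeNeighbours i j q-inj with <-cmp (toℕ (q (inj₁ i))) (toℕ (q (inj₂ j)))
  ... | tri< i<j _ _ = narrowToNeighbours (toℕ (q (inj₂ j))) knower-left  i<j (m≤n+m _ _)
  ... | tri> _ _ j<i = narrowToNeighbours (toℕ (q (inj₁ i))) knower-right j<i (m≤n+m _ _)
  ... | tri≈ _ i≡j _ with q-inj {inj₁ i} {inj₂ j} (toℕ-injective i≡j)
  ... | ()

  -- The x + y agents occupy distinct vertices outside the empty stretch between the neighbours.
  neighbours-close : Injective _≡_ _≡_ q → (nb : OppositeNeighbours) → let open OppositeNeighbours nb in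
                     toℕ (q right) ≤ toℕ (q left) + suc (n ∸ (x + y))
  neighbours-close q-inj nb with m≤n⇒∃[o]m+o≡n (OppositeNeighbours.ordered nb)
  ... | e , 1+l+e≡r = begin
    toℕ (q right)         ≡⟨ sym 1+l+e≡r ⟩
    suc (toℕ (q left) + e) ≡⟨ sym (+-suc _ e) ⟩
    toℕ (q left) + suc e  ≤⟨ +-monoʳ-≤ _ (s≤s (subst (λ m → e ≤ n ∸ m) (+-comm y x) (m+n≤o⇒m≤o∸n e e+m≤n))) ⟩
    toℕ (q left) + suc (n ∸ (x + y)) ∎
    where
    open OppositeNeighbours nb
    open ≤-Reasoning
    e+m≤n : e + (y + x) ≤ n
    e+m≤n = injective-avoiding-interval⇒≤ {f = q ∘ splitAt y} (splitAt-injective y ∘ q-inj) (suc (toℕ (q left))) e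
              (subst (_≤ n) (sym 1+l+e≡r) (<⇒≤ (toℕ<n (q right))))
              (λ i (l<i , i<e) → nothing-between (splitAt y i) (l<i , subst (_ <_) 1+l+e≡r i<e))

agents-win : ∀ {n x y} → 1 ≤ x → 1 ≤ y → ∀ T → n ∸ (x + y) < 2 * T →
             (p : Placement n x y) → AgentsWin (PathGraph n) T (initial (proj₁ p))
agents-win {n} {x} {y} 1≤x 1≤y T gap<2T (q , q-inj) =
  chase T (initial q) (opposite⇒informs opposite) ordered
        (≤-trans (neighbours-close q q-inj nb) (+-monoʳ-≤ _ gap<2T))
  where
  nb : OppositeNeighbours q
  nb = oppositeNeighbours q (fromℕ< 1≤y) (fromℕ< 1≤x) q-inj
  open OppositeNeighbours nb

mainTheorem7 : (n x y : ℕ) → 1 ≤ x → 1 ≤ y → x + y ≤ n → (T : ℕ) →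
    (2 * T ≤ n ∸ (x + y) →
       Σ (Placement n x y) (λ p → AdvSurvives (PathGraph n) T (initial (proj₁ p))))
    × (n ∸ (x + y) < 2 * T →
       (p : Placement n x y) → AgentsWin (PathGraph n) T (initial (proj₁ p)))
mainTheorem7 n x y 1≤x 1≤y x+y≤n T = adversary-survives {n} {x} {y} x+y≤n T , agents-win 1≤x 1≤y T
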